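{- Let $\mathfrak a_{n,m}$ be the number of $\sigma\in\mathcal{I}_n(101,120)$ with $\max(\sigma)=m$, and let $\mathfrak a'_{n,m}$ be the number of those $\sigma$ which moreover satisfy $\sigma_n=m$. Let $\mathfrak b_{n,k}=\sum_{\ell=0}^{n}|\mathcal W_{\ell,k}(101,120)|$ be the number of words of length at most $n$ over $\{0,\dots,k-1\}$ avoiding both $101$ and $120$. Then for all integers $0<m<n$, $$\mathfrak a_{n,m}=\sum_{p=m+1}^{n}\sum_{j=0}^{m-1}\Big(\mathfrak a'_{p-1,j}\,\mathfrak b_{n-p,m-j}+(\mathfrak a_{p-1,j}-\mathfrak a'_{p-1,j})\,\mathfrak b_{n-p,m-j-1}\Big),$$ $$\mathfrak a'_{n,m}=\sum_{p=m+1}^{n}\sum_{j=0}^{m-1}\mathfrak a_{p-1,j}.$$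
   Context: For $n\in\mathbb N$, an inversion sequence of size $n$ is a sequence $\sigma=(\sigma_1,\dots,\sigma_n)\in\mathbb N^n$ with $\sigma_i<i$ for all $i$. An integer sequence contains a pattern $\rho$ (a finite integer sequence such as $101$ or $120$) if it has a subsequence order-isomorphic to $\rho$, and avoids $\rho$ otherwise. $\mathcal{I}_n(P)$ denotes the set of inversion sequences of size $n$ avoiding every pattern in the set $P$. $\mathcal W_{n,k}=\{0,\dots,k-1\}^n$ is the set of words of length $n$ over $\{0,\dots,k-1\}$, and $\mathcal W_{n,k}(P)$ its subset of words avoiding every pattern in $P$. $\max(\sigma)$ is the largest entry of $\sigma$. -}

module Defs where

open import Data.Nat using (ℕ; zero; suc; _+_; _<_; _⊔_)
open import Data.Fin using (Fin; toℕ)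
open import Data.Vec using (Vec; lookup; toList)
open import Data.List using (List; []; _∷_; length; foldr)
open import Data.List.Relation.Binary.Sublist.Propositional using (_⊆_)
open import Data.List.Relation.Binary.Pointwise using (Pointwise)
open import Data.List.Relation.Unary.Unique.Propositional using (Unique)
open import Data.List.Membership.Propositional using (_∈_)
open import Data.Product using (Σ; _×_; ∃)
open import Data.Unit using (⊤)
open import Data.Empty using (⊥)
open import Function.Bundles using (_⇔_)
open import Relation.Nullary using (¬_)
open import Relation.Binary.PropositionalEquality using (_≡_)

SameCmp : ℕ → ℕ → ℕ → ℕ → Set
SameCmp a b x y = ((a < x) ⇔ (b < y)) × ((x < a) ⇔ (y < b))

OrderIso : List ℕ → List ℕ → Set
OrderIso [] [] = ⊤
OrderIso [] (_ ∷ _) = ⊥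
OrderIso (_ ∷ _) [] = ⊥
OrderIso (a ∷ ρ) (b ∷ τ) = Pointwise (SameCmp a b) ρ τ × OrderIso ρ τ

Contains : List ℕ → List ℕ → Set
Contains ρ s = ∃ λ τ → (τ ⊆ s) × OrderIso ρ τ

Avoids : List ℕ → List ℕ → Set
Avoids ρ s = ¬ Contains ρ s

p101 : List ℕ
p101 = 1 ∷ 0 ∷ 1 ∷ []

p120 : List ℕ
p120 = 1 ∷ 2 ∷ 0 ∷ []

Avoids101-120 : List ℕ → Set
Avoids101-120 s = Avoids p101 s × Avoids p120 s

-- inversion sequence of size n: σ_i < i for i = 1..n (Fin index i stands for i+1)
IsInvSeq : {n : ℕ} → Vec ℕ n → Set
IsInvSeq {n} σ = (i : Fin n) → lookup σ i < suc (toℕ i)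

IsWord : {n : ℕ} → ℕ → Vec ℕ n → Set
IsWord {n} k w = (i : Fin n) → lookup w i < k

maxSeq : {n : ℕ} → Vec ℕ n → ℕ
maxSeq σ = foldr _⊔_ 0 (toList σ)

IsCount : {A : Set} → (A → Set) → ℕ → Set
IsCount {A} P N = Σ (List A) λ L → Unique L × ((x : A) → (x ∈ L) ⇔ P x) × (length L ≡ N)

-- ∑_{i=lo}^{hi} f i  (0 if hi < lo): sumFrom lo c f = f lo + … + f (lo + c - 1)
sumFrom : ℕ → ℕ → (ℕ → ℕ) → ℕ
sumFrom lo zero f = 0
sumFrom lo (suc c) f = f lo + sumFrom (suc lo) c f

module Submission where

-- Cut σ ∈ 𝓘_n(101,120) with max σ = m > 0 at the first m: σ = τ m^(k+1) u with τ < m. Avoiding 101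
-- forces u < m, avoiding 120 forces u ≥ j = max τ, and if τ does not end in j then 101 even forces
-- u > j; conversely every such gluing avoids both patterns, and it is an inversion sequence iff τ is
-- one and |τ| ≥ m. So σ is determined by p = |τ| + 1, by τ ∈ 𝓘_{p-1}(101,120) with max j, and by the
-- word u - j over {0,…,m-j-1} (or u - j - 1 over {0,…,m-j-2} when τ does not end in j) of length at
-- most n - p. Counting these data gives the formula for a; σ ends in m exactly when u is empty, which
-- gives the formula for a′.

open import Defs
open import Data.Nat using (ℕ; zero; suc; _+_; _*_; _∸_; _<_; _≤_; _⊔_; _≟_; z≤n; s≤s; s≤s⁻¹)
open import Data.Nat.Properties
open import Data.Fin using (Fin; toℕ) renaming (zero to fzero; suc to fsuc)
open import Data.Vec as Vec using (Vec; lookup; toList; fromList; last)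
open import Data.Vec.Properties using (toList-injective; cast-is-id; length-toList; toList∘fromList)
import Data.Vec.Relation.Unary.All.Properties as VecAll
open import Data.List as List
  using (List; []; _∷_; length; _++_; map; foldr; replicate; head; filter; cartesianProduct)
open import Data.List.Properties
  using (length-++; length-map; length-replicate; ++-assoc; ∷-injectiveˡ; ∷-injectiveʳ; map-injective)
open import Data.List.Membership.Propositional using (_∈_)
open import Data.List.Membership.Propositional.Properties
  using (∈-map⁺; ∈-map⁻; ∈-++⁺ʳ; ∈-++⁻; ++-∈⇔; ∈-filter⁺; ∈-filter⁻; ∈-cartesianProduct⁺; ∈-cartesianProduct⁻)
open import Data.List.Membership.Propositional.Properties.WithK using (unique∧set⇒bag)
open import Data.List.Relation.Binary.BagAndSetEquality using (∼bag⇒↭)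
open import Data.List.Relation.Binary.Permutation.Propositional.Properties using (↭-length)
open import Data.List.Relation.Binary.Pointwise using ([]; _∷_)
open import Data.List.Relation.Binary.Sublist.Propositional using (_⊆_; []; _∷_; _∷ʳ_; ⊆-refl; ⊆-trans; from∈; to∈)
open import Data.List.Relation.Binary.Sublist.Propositional.Properties using (map⁺; ++⁺; ++⁺ˡ; ++⁺ʳ; All-resp-⊆)
open import Data.List.Relation.Unary.All as All using (All; []; _∷_)
import Data.List.Relation.Unary.All.Properties as Allₚ
open import Data.List.Relation.Unary.AllPairs using ([]; _∷_)
open import Data.List.Relation.Unary.Any using (here; there)
open import Data.List.Relation.Unary.Unique.Propositional using (Unique)
import Data.List.Relation.Unary.Unique.Propositional.Properties as Unique
open import Data.Maybe using (just)
open import Data.Maybe.Properties using (just-injective)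
open import Data.Product as Product using (∃; _×_; _,_; proj₁; proj₂)
open import Data.Sum as Sum using (_⊎_; inj₁; inj₂; [_,_])
open import Data.Unit using (⊤; tt)
open import Data.Empty using (⊥-elim)
open import Function using (_∘_)
open import Function.Bundles using (_⇔_; mk⇔; Equivalence)
import Function.Properties.Equivalence as ⇔
open import Relation.Nullary using (¬_; ¬?; Dec; yes; no; contradiction)
open import Relation.Nullary.Decidable using (toSum)
open import Relation.Unary using (Decidable)
open import Relation.Binary.Definitions using (tri<; tri≈; tri>)
open import Relation.Binary.PropositionalEquality
  using (_≡_; _≢_; refl; sym; trans; cong; cong₂; subst; subst₂; module ≡-Reasoning)

-- Counting

module _ {A : Set} where

  IsCount-unique : {P : A → Set} {n n′ : ℕ} → IsCount P n → IsCount P n′ → n ≡ n′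
  IsCount-unique (L , L! , L≈P , refl) (L′ , L′! , L′≈P , refl) =
    ↭-length (∼bag⇒↭ (unique∧set⇒bag L! L′! λ {x} → ⇔.trans (L≈P x) (⇔.sym (L′≈P x))))

  IsCount-resp : {P Q : A → Set} {n : ℕ} → (∀ x → P x ⇔ Q x) → IsCount P n → IsCount Q n
  IsCount-resp P⇔Q (L , L! , L≈P , |L|) = L , L! , (λ x → ⇔.trans (L≈P x) (P⇔Q x)) , |L|

  IsCount-∅ : {P : A → Set} → (∀ x → ¬ P x) → IsCount P 0
  IsCount-∅ ¬P = [] , [] , (λ x → mk⇔ (λ ()) (⊥-elim ∘ ¬P x)) , refl

  IsCount-⊎ : {P Q : A → Set} {a b : ℕ} → IsCount P a → IsCount Q b → (∀ x → P x → ¬ Q x)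
    → IsCount (λ x → P x ⊎ Q x) (a + b)
  IsCount-⊎ (L , L! , L≈P , refl) (L′ , L′! , L′≈Q , refl) P∩Q=∅ =
    L ++ L′ ,
    Unique.++⁺ L! L′! (λ (x∈L , x∈L′) → P∩Q=∅ _ (to (L≈P _) x∈L) (to (L′≈Q _) x∈L′)) ,
    (λ x → ⇔.trans ++-∈⇔ (mk⇔ [ inj₁ ∘ to (L≈P x) , inj₂ ∘ to (L′≈Q x) ]
                                [ inj₁ ∘ from (L≈P x) , inj₂ ∘ from (L′≈Q x) ])) ,
    length-++ L
    where open Equivalence

  IsCount-filter : {P Q : A → Set} {n : ℕ} → Decidable Q → IsCount P n
    → ∃ λ c → IsCount (λ x → P x × Q x) c
  IsCount-filter Q? (L , L! , L≈P , _) =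
    _ , filter Q? L , Unique.filter⁺ Q? L! ,
    (λ x → mk⇔ (λ x∈ → let (x∈L , q) = ∈-filter⁻ Q? x∈ in Equivalence.to (L≈P x) x∈L , q)
                (λ (p , q) → ∈-filter⁺ Q? (Equivalence.from (L≈P x) p) q)) ,
    refl

  IsCount-∖ : {P Q : A → Set} {n c : ℕ} → Decidable Q → IsCount P n → IsCount (λ x → P x × Q x) c
    → IsCount (λ x → P x × ¬ Q x) (n ∸ c)
  IsCount-∖ {P} {Q} {n} {c} Q? P# P∩Q# = subst (IsCount _) d≡n∸c P∖Q#
    where
    P∖Q? = IsCount-filter (λ x → ¬? (Q? x)) P#
    d = proj₁ P∖Q?
    P∖Q# = proj₂ P∖Q?
    split : ∀ x → ((P x × Q x) ⊎ (P x × ¬ Q x)) ⇔ P x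
    split x = mk⇔ [ proj₁ , proj₁ ] λ p → Sum.map (p ,_) (p ,_) (toSum (Q? x))
    n≡c+d : n ≡ c + d
    n≡c+d = IsCount-unique P# (IsCount-resp split (IsCount-⊎ P∩Q# P∖Q# λ _ (_ , q) (_ , ¬q) → ¬q q))
    d≡n∸c : d ≡ n ∸ c
    d≡n∸c = trans (sym (m+n∸m≡n c d)) (cong (_∸ c) (sym n≡c+d))

module _ {A B : Set} where

  Unique-map⁺-on : (f : A → B) {L : List A} → (∀ {x y} → x ∈ L → y ∈ L → f x ≡ f y → x ≡ y)
    → Unique L → Unique (map f L)
  Unique-map⁺-on f {[]} inj [] = []
  Unique-map⁺-on f {x ∷ L} inj (x∉L ∷ L!) =
    Allₚ.map⁺ (All.tabulate λ y∈L fx≡fy → All.lookup x∉L y∈L (inj (here refl) (there y∈L) fx≡fy)) ∷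
    Unique-map⁺-on f (λ x∈L y∈L → inj (there x∈L) (there y∈L)) L!

  IsCount-image : {P : A → Set} {n : ℕ} (f : A → B) → (∀ {x y} → P x → P y → f x ≡ f y → x ≡ y)
    → IsCount P n → IsCount (λ y → ∃ λ x → P x × f x ≡ y) n
  IsCount-image f inj (L , L! , L≈P , refl) =
    map f L ,
    Unique-map⁺-on f (λ x∈L y∈L → inj (to (L≈P _) x∈L) (to (L≈P _) y∈L)) L! ,
    (λ y → mk⇔ (λ y∈ → let (x , x∈L , y≡fx) = ∈-map⁻ f y∈ in x , to (L≈P x) x∈L , sym y≡fx)
                λ { (x , p , refl) → ∈-map⁺ f (from (L≈P x) p) }) ,
    length-map f L
    where open Equivalence

  length-cartesianProduct : (xs : List A) (ys : List B)
    → length (cartesianProduct xs ys) ≡ length xs * length ys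
  length-cartesianProduct []       ys = refl
  length-cartesianProduct (x ∷ xs) ys = begin
    length (map (x ,_) ys ++ cartesianProduct xs ys)        ≡⟨ length-++ (map (x ,_) ys) ⟩
    length (map (x ,_) ys) + length (cartesianProduct xs ys) ≡⟨ cong₂ _+_ (length-map (x ,_) ys) (length-cartesianProduct xs ys) ⟩
    length ys + length xs * length ys                        ∎
    where open ≡-Reasoning

  IsCount-× : {P : A → Set} {Q : B → Set} {a b : ℕ} → IsCount P a → IsCount Q b
    → IsCount (λ (xy : A × B) → P (proj₁ xy) × Q (proj₂ xy)) (a * b)
  IsCount-× (L , L! , L≈P , refl) (L′ , L′! , L′≈Q , refl) =
    cartesianProduct L L′ ,
    Unique.cartesianProduct⁺ L! L′! ,
    (λ (x , y) → mk⇔ (λ xy∈ → let (x∈L , y∈L′) = ∈-cartesianProduct⁻ L L′ xy∈ in to (L≈P x) x∈L , to (L′≈Q y) y∈L′)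
                      (λ (p , q) → ∈-cartesianProduct⁺ (from (L≈P x) p) (from (L′≈Q y) q))) ,
    length-cartesianProduct L L′
    where open Equivalence

InRange : ℕ → ℕ → ℕ → Set
InRange lo c i = lo ≤ i × i < lo + c

module _ {A : Set} where

  IsCount-Σ-range : (P : ℕ → A → Set) (f : ℕ → ℕ) (lo c : ℕ)
    → (∀ i → InRange lo c i → IsCount (P i) (f i))
    → (∀ {i i′ x} → InRange lo c i → InRange lo c i′ → P i x → P i′ x → i ≡ i′)
    → IsCount (λ x → ∃ λ i → InRange lo c i × P i x) (sumFrom lo c f)
  IsCount-Σ-range P f lo zero _ _ =
    IsCount-∅ λ { x (i , (lo≤i , i<lo+0) , _) → <⇒≱ (subst (i <_) (+-identityʳ lo) i<lo+0) lo≤i }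
  IsCount-Σ-range P f lo (suc c) count disjoint =
    IsCount-resp split
      (IsCount-⊎ (count lo lo∈) (IsCount-Σ-range P f (suc lo) c (λ i → count i ∘ widen) (λ i∈ i′∈ → disjoint (widen i∈) (widen i′∈)))
        λ { x p (i , i∈ , q) → <⇒≢ (proj₁ i∈) (disjoint lo∈ (widen i∈) p q) })
    where
    shift : ∀ {i} → i < suc lo + c → i < lo + suc c
    shift {i} = subst (i <_) (sym (+-suc lo c))
    lo∈ : InRange lo (suc c) lo
    lo∈ = ≤-refl , shift (s≤s (m≤m+n lo c))
    widen : ∀ {i} → InRange (suc lo) c i → InRange lo (suc c) i
    widen (lo<i , i<) = <⇒≤ lo<i , shift i<
    split : ∀ x → (P lo x ⊎ ∃ λ i → InRange (suc lo) c i × P i x) ⇔ (∃ λ i → InRange lo (suc c) i × P i x)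
    split x = mk⇔ [ (λ p → lo , lo∈ , p) , (λ (i , i∈ , p) → i , widen i∈ , p) ] narrow
      where
      narrow : (∃ λ i → InRange lo (suc c) i × P i x) → P lo x ⊎ ∃ λ i → InRange (suc lo) c i × P i x
      narrow (i , (lo≤i , i<) , p) with m≤n⇒m<n∨m≡n lo≤i
      ... | inj₁ lo<i = inj₂ (i , (lo<i , subst (i <_) (+-suc lo c) i<) , p)
      ... | inj₂ refl = inj₁ p

-- Maximum, last entry and the inversion condition on lists

maxL : List ℕ → ℕ
maxL = foldr _⊔_ 0

≤-maxL : ∀ s → All (_≤ maxL s) s
≤-maxL []      = []
≤-maxL (x ∷ s) = m≤m⊔n x (maxL s) ∷ All.map (λ y≤ → ≤-trans y≤ (m≤n⊔m x (maxL s))) (≤-maxL s)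

maxL≤ : ∀ {k} s → All (_≤ k) s → maxL s ≤ k
maxL≤ []      []         = z≤n
maxL≤ (x ∷ s) (x≤ ∷ s≤) = ⊔-lub x≤ (maxL≤ s s≤)

maxL-∈ : ∀ s → 0 < length s → maxL s ∈ s
maxL-∈ (x ∷ s) _ = maxL-∈-∷ x s
  where
  maxL-∈-∷ : ∀ x s → maxL (x ∷ s) ∈ x ∷ s
  maxL-∈-∷ x []      = here (⊔-identityʳ x)
  maxL-∈-∷ x (y ∷ s) with ⊔-sel x (maxL (y ∷ s))
  ... | inj₁ max≡x = here max≡x
  ... | inj₂ max≡  = there (subst (_∈ y ∷ s) (sym max≡) (maxL-∈-∷ y s))

maxL≡⁻ : ∀ {m} s → 0 < m → maxL s ≡ m → All (_≤ m) s × m ∈ s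
maxL≡⁻ []      0<m max≡m = contradiction max≡m (<⇒≢ 0<m)
maxL≡⁻ (x ∷ s) _   refl  = ≤-maxL (x ∷ s) , maxL-∈ (x ∷ s) (s≤s z≤n)

maxL≡⁺ : ∀ {m} s → All (_≤ m) s → m ∈ s → maxL s ≡ m
maxL≡⁺ s s≤m m∈s = ≤-antisym (maxL≤ s s≤m) (All.lookup (≤-maxL s) m∈s)

maxL-< : ∀ {m} s → 0 < m → All (_< m) s → maxL s < m
maxL-< []      0<m []          = 0<m
maxL-< (x ∷ s) 0<m (x< ∷ s<) = ⊔-lub x< (maxL-< s 0<m s<)

All<-maxL : ∀ {m j} τ → maxL τ ≡ j → j < m → All (_< m) τ
All<-maxL τ refl j<m = All.map (λ x≤j → ≤-<-trans x≤j j<m) (≤-maxL τ)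

lastL : List ℕ → ℕ
lastL []           = 0
lastL (x ∷ [])     = x
lastL (_ ∷ y ∷ s) = lastL (y ∷ s)

lastL-++ : ∀ xs y ys → lastL (xs ++ y ∷ ys) ≡ lastL (y ∷ ys)
lastL-++ []           y ys = refl
lastL-++ (x ∷ [])     y ys = refl
lastL-++ (_ ∷ x ∷ xs) y ys = lastL-++ (x ∷ xs) y ys

lastL-∈ : ∀ y ys → lastL (y ∷ ys) ∈ y ∷ ys
lastL-∈ y []       = here refl
lastL-∈ y (z ∷ ys) = there (lastL-∈ z ys)

lastL-split : ∀ x s → ∃ λ s′ → x ∷ s ≡ s′ ++ lastL (x ∷ s) ∷ []
lastL-split x []      = [] , refl
lastL-split x (y ∷ s) with lastL-split y s
... | s′ , eq = x ∷ s′ , cong (x ∷_) eq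

last≡lastL : ∀ {n} (σ : Vec ℕ (suc n)) → last σ ≡ lastL (toList σ)
last≡lastL {zero}  (x Vec.∷ Vec.[])     = refl
last≡lastL {suc n} (_ Vec.∷ y Vec.∷ σ) = last≡lastL (y Vec.∷ σ)

InvFrom : ℕ → List ℕ → Set
InvFrom k []       = ⊤
InvFrom k (x ∷ xs) = x < suc k × InvFrom (suc k) xs

IsInvList : List ℕ → Set
IsInvList = InvFrom 0

InvFrom-++⁻ : ∀ k xs ys → InvFrom k (xs ++ ys) → InvFrom k xs × InvFrom (length xs + k) ys
InvFrom-++⁻ k []       ys inv       = tt , inv
InvFrom-++⁻ k (x ∷ xs) ys (x< , inv) with InvFrom-++⁻ (suc k) xs ys inv
... | xs-inv , ys-inv = (x< , xs-inv) , subst (λ k′ → InvFrom k′ ys) (+-suc (length xs) k) ys-inv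

InvFrom-++⁺ : ∀ k xs ys → InvFrom k xs → InvFrom (length xs + k) ys → InvFrom k (xs ++ ys)
InvFrom-++⁺ k []       ys _            ys-inv = ys-inv
InvFrom-++⁺ k (x ∷ xs) ys (x< , xs-inv) ys-inv =
  x< , InvFrom-++⁺ (suc k) xs ys xs-inv (subst (λ k′ → InvFrom k′ ys) (sym (+-suc (length xs) k)) ys-inv)

InvFrom-≤ : ∀ {k} ys → All (_≤ k) ys → InvFrom k ys
InvFrom-≤ []       []          = tt
InvFrom-≤ (y ∷ ys) (y≤ ∷ ys≤) = s≤s y≤ , InvFrom-≤ ys (All.map m≤n⇒m≤1+n ys≤)

IsInvSeq⇔InvFrom : ∀ {n} (σ : Vec ℕ n) k
  → ((i : Fin n) → lookup σ i < suc (k + toℕ i)) ⇔ InvFrom k (toList σ)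
IsInvSeq⇔InvFrom σ k = mk⇔ (to σ k) (from σ k)
  where
  to : ∀ {n} (σ : Vec ℕ n) k → ((i : Fin n) → lookup σ i < suc (k + toℕ i)) → InvFrom k (toList σ)
  to Vec.[]       k inv = tt
  to (x Vec.∷ σ) k inv =
    subst (λ k′ → x < suc k′) (+-identityʳ k) (inv fzero) ,
    to σ (suc k) (λ i → subst (λ k′ → lookup σ i < suc k′) (+-suc k (toℕ i)) (inv (fsuc i)))
  from : ∀ {n} (σ : Vec ℕ n) k → InvFrom k (toList σ) → (i : Fin n) → lookup σ i < suc (k + toℕ i)
  from (x Vec.∷ σ) k (x< , inv) fzero    = subst (λ k′ → x < suc k′) (sym (+-identityʳ k)) x<
  from (x Vec.∷ σ) k (x< , inv) (fsuc i) =
    subst (λ k′ → lookup σ i < suc k′) (sym (+-suc k (toℕ i))) (from σ (suc k) inv i)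

IsWord⇔All : ∀ {n} k (v : Vec ℕ n) → IsWord k v ⇔ All (_< k) (toList v)
IsWord⇔All k v = mk⇔ (λ w → VecAll.toList⁺ (VecAll.lookup⁻ w)) (λ all → VecAll.lookup⁺ (VecAll.toList⁻ all))

IsCount-toList : ∀ n (Q : List ℕ → Set) {c} → IsCount (λ (σ : Vec ℕ n) → Q (toList σ)) c
  → IsCount (λ s → length s ≡ n × Q s) c
IsCount-toList n Q σ# =
  IsCount-resp (λ s → mk⇔ (λ { (σ , q , refl) → length-toList σ , q })
                          (λ { (refl , q) → fromList s , subst Q (sym (toList∘fromList s)) q , toList∘fromList s }))
    (IsCount-image toList (λ {σ} {σ′} _ _ eq → trans (sym (cast-is-id refl σ)) (toList-injective refl σ σ′ eq)) σ#)

-- The patterns 101 and 120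

-- a b c is order-isomorphic to 101 or to 120
Forbidden : ℕ → ℕ → ℕ → Set
Forbidden a b c = (b < a × c ≡ a) ⊎ (c < a × a < b)

NoForbidden : List ℕ → Set
NoForbidden s = ∀ {a b c} → (a ∷ b ∷ c ∷ []) ⊆ s → ¬ Forbidden a b c

module _ {p q x y : ℕ} where

  SameCmp-< : p < x → q < y → SameCmp p q x y
  SameCmp-< p<x q<y = mk⇔ (λ _ → q<y) (λ _ → p<x) , mk⇔ (contradiction p<x ∘ <-asym) (contradiction q<y ∘ <-asym)

  SameCmp-> : x < p → y < q → SameCmp p q x y
  SameCmp-> x<p y<q = mk⇔ (contradiction x<p ∘ <-asym) (contradiction y<q ∘ <-asym) , mk⇔ (λ _ → y<q) (λ _ → x<p)

  SameCmp-≡ : p ≡ x → q ≡ y → SameCmp p q x y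
  SameCmp-≡ refl refl = mk⇔ absurd absurd , mk⇔ absurd absurd
    where
    absurd : ∀ {z} {B : Set} → z < z → B
    absurd z<z = contradiction z<z (<-irrefl refl)

  SameCmp⁻-< : p < x → SameCmp p q x y → q < y
  SameCmp⁻-< p<x (p<x⇔q<y , _) = Equivalence.to p<x⇔q<y p<x

  SameCmp⁻-> : x < p → SameCmp p q x y → y < q
  SameCmp⁻-> x<p (_ , x<p⇔y<q) = Equivalence.to x<p⇔y<q x<p

  SameCmp⁻-≡ : p ≡ x → SameCmp p q x y → q ≡ y
  SameCmp⁻-≡ refl (p<p⇔q<y , y<q⇔p<p) with <-cmp q y
  ... | tri< q<y _ _ = contradiction (Equivalence.from p<p⇔q<y q<y) (<-irrefl refl)
  ... | tri≈ _ q≡y _ = q≡y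
  ... | tri> _ _ y<q = contradiction (Equivalence.from y<q⇔p<p y<q) (<-irrefl refl)

Avoids⇒NoForbidden : ∀ {s} → Avoids101-120 s → NoForbidden s
Avoids⇒NoForbidden (¬101 , _) abc⊆s (inj₁ (b<a , refl)) =
  ¬101 (_ , abc⊆s , (SameCmp-> 0<1 b<a ∷ SameCmp-≡ refl refl ∷ []) , (SameCmp-< 0<1 b<a ∷ []) , [] , tt)
  where 0<1 = s≤s z≤n
Avoids⇒NoForbidden (_ , ¬120) abc⊆s (inj₂ (c<a , a<b)) =
  ¬120 (_ , abc⊆s , (SameCmp-< 1<2 a<b ∷ SameCmp-> 0<1 c<a ∷ []) , (SameCmp-> 0<2 (<-trans c<a a<b) ∷ []) , [] , tt)
  where 0<1 = s≤s z≤n; 0<2 = s≤s z≤n; 1<2 = s≤s (s≤s z≤n)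

NoForbidden⇒Avoids : ∀ {s} → NoForbidden s → Avoids101-120 s
NoForbidden⇒Avoids {s} nf = ¬101 , ¬120
  where
  ¬101 : ¬ Contains p101 s
  ¬101 ((a ∷ b ∷ c ∷ []) , abc⊆s , (ab ∷ ac ∷ []) , _) =
    nf abc⊆s (inj₁ (SameCmp⁻-> (s≤s z≤n) ab , sym (SameCmp⁻-≡ refl ac)))
  ¬120 : ¬ Contains p120 s
  ¬120 ((a ∷ b ∷ c ∷ []) , abc⊆s , (ab ∷ ac ∷ []) , _) =
    nf abc⊆s (inj₂ (SameCmp⁻-> (s≤s z≤n) ac , SameCmp⁻-< (s≤s (s≤s z≤n)) ab))

NoForbidden-⊆ : ∀ {s t} → t ⊆ s → NoForbidden s → NoForbidden t
NoForbidden-⊆ t⊆s nf abc⊆t = nf (⊆-trans abc⊆t t⊆s)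

⊆-map⁻ : (f : ℕ → ℕ) (v : List ℕ) {zs : List ℕ} → zs ⊆ map f v → ∃ λ zs₀ → zs₀ ⊆ v × zs ≡ map f zs₀
⊆-map⁻ f []      []            = [] , [] , refl
⊆-map⁻ f (y ∷ v) (_ ∷ʳ zs⊆)  with ⊆-map⁻ f v zs⊆
... | zs₀ , zs₀⊆v , refl = zs₀ , y ∷ʳ zs₀⊆v , refl
⊆-map⁻ f (y ∷ v) (refl ∷ zs⊆) with ⊆-map⁻ f v zs⊆
... | zs₀ , zs₀⊆v , refl = y ∷ zs₀ , refl ∷ zs₀⊆v , refl

Forbidden-+ : ∀ s {a b c} → Forbidden (a + s) (b + s) (c + s) ⇔ Forbidden a b c
Forbidden-+ s {a} {b} {c} = mk⇔
  (λ { (inj₁ (b<a , c≡a)) → inj₁ (+-cancelʳ-< s b a b<a , +-cancelʳ-≡ s c a c≡a)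
     ; (inj₂ (c<a , a<b)) → inj₂ (+-cancelʳ-< s c a c<a , +-cancelʳ-< s a b a<b) })
  (λ { (inj₁ (b<a , refl)) → inj₁ (+-monoˡ-< s b<a , refl)
     ; (inj₂ (c<a , a<b)) → inj₂ (+-monoˡ-< s c<a , +-monoˡ-< s a<b) })

NoForbidden-map-+ : ∀ s v → NoForbidden v ⇔ NoForbidden (map (_+ s) v)
NoForbidden-map-+ s v = mk⇔ to from
  where
  to : NoForbidden v → NoForbidden (map (_+ s) v)
  to nf abc⊆ with ⊆-map⁻ (_+ s) v abc⊆
  ... | _ ∷ _ ∷ _ ∷ [] , abc₀⊆v , refl = nf abc₀⊆v ∘ Equivalence.to (Forbidden-+ s)
  from : NoForbidden (map (_+ s) v) → NoForbidden v
  from nf abc⊆v = nf (map⁺ (_+ s) abc⊆v) ∘ Equivalence.from (Forbidden-+ s)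

⊆-++⁻ : ∀ (xs : List ℕ) {ys zs} → zs ⊆ xs ++ ys
  → ∃ λ zs₁ → ∃ λ zs₂ → zs ≡ zs₁ ++ zs₂ × zs₁ ⊆ xs × zs₂ ⊆ ys
⊆-++⁻ []       {zs = zs} zs⊆ = [] , zs , refl , [] , zs⊆
⊆-++⁻ (x ∷ xs) (.x ∷ʳ zs⊆) with ⊆-++⁻ xs zs⊆
... | zs₁ , zs₂ , refl , zs₁⊆ , zs₂⊆ = zs₁ , zs₂ , refl , x ∷ʳ zs₁⊆ , zs₂⊆
⊆-++⁻ (x ∷ xs) (refl ∷ zs⊆) with ⊆-++⁻ xs zs⊆
... | zs₁ , zs₂ , refl , zs₁⊆ , zs₂⊆ = x ∷ zs₁ , zs₂ , refl , refl ∷ zs₁⊆ , zs₂⊆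

NoForbidden-++ : ∀ {xs ys} → NoForbidden xs → NoForbidden ys
  → (∀ {a b c} → a ∈ xs → (b ∷ c ∷ []) ⊆ ys → ¬ Forbidden a b c)
  → (∀ {a b c} → (a ∷ b ∷ []) ⊆ xs → c ∈ ys → ¬ Forbidden a b c)
  → NoForbidden (xs ++ ys)
NoForbidden-++ {xs} nf-xs nf-ys cross₁ cross₂ abc⊆ with ⊆-++⁻ xs abc⊆
... | []              , _ , refl , _   , bc⊆ = nf-ys bc⊆
... | _ ∷ []          , _ , refl , a⊆ , bc⊆ = cross₁ (to∈ a⊆) bc⊆
... | _ ∷ _ ∷ []      , _ , refl , ab⊆ , c⊆ = cross₂ ab⊆ (to∈ c⊆)
... | _ ∷ _ ∷ _ ∷ [] , _ , refl , abc⊆xs , _ = nf-xs abc⊆xs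

-- Cutting at the first maximum

triple-⊆ : ∀ {a b c : ℕ} {xs ys zs} → a ∈ xs → b ∈ ys → c ∈ zs → (a ∷ b ∷ c ∷ []) ⊆ xs ++ ys ++ zs
triple-⊆ a∈ b∈ c∈ = ++⁺ (from∈ a∈) (++⁺ (from∈ b∈) (from∈ c∈))

NoForbidden-101 : ∀ xs ys {zs a b} → NoForbidden (xs ++ ys ++ zs) → a ∈ xs → b ∈ ys → b < a → All (_≢ a) zs
NoForbidden-101 _ _ nf a∈ b∈ b<a = All.tabulate λ c∈ c≡a → nf (triple-⊆ a∈ b∈ c∈) (inj₁ (b<a , c≡a))

NoForbidden-120 : ∀ xs ys {zs a b} → NoForbidden (xs ++ ys ++ zs) → a ∈ xs → b ∈ ys → a < b → All (a ≤_) zs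
NoForbidden-120 _ _ nf a∈ b∈ a<b = All.tabulate λ c∈ → ≮⇒≥ λ c<a → nf (triple-⊆ a∈ b∈ c∈) (inj₂ (c<a , a<b))

¬Forbidden-≡ : ∀ {a c} → ¬ Forbidden a a c
¬Forbidden-≡ (inj₁ (a<a , _)) = <-irrefl refl a<a
¬Forbidden-≡ (inj₂ (_ , a<a)) = <-irrefl refl a<a

¬Forbidden-top : ∀ {a b c} → b ≤ a → c < a → ¬ Forbidden a b c
¬Forbidden-top _   c<a (inj₁ (_ , refl)) = <-irrefl refl c<a
¬Forbidden-top b≤a _   (inj₂ (_ , a<b)) = <⇒≱ a<b b≤a

¬Forbidden-bottom : ∀ {a b c} → a ≤ b → a ≤ c → ¬ Forbidden a b c
¬Forbidden-bottom a≤b _   (inj₁ (b<a , _)) = <⇒≱ b<a a≤b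
¬Forbidden-bottom _   a≤c (inj₂ (c<a , _)) = <⇒≱ c<a a≤c

assemble : List ℕ → ℕ → ℕ → List ℕ → List ℕ
assemble τ m k u = τ ++ m ∷ (replicate k m ++ u)

record Decomposition (m : ℕ) (τ u : List ℕ) : Set where
  field
    prefix<m      : All (_< m) τ
    m≤length      : m ≤ length τ
    prefix-inv    : IsInvList τ
    prefix-nf     : NoForbidden τ
    suffix<m      : All (_< m) u
    suffix-nf     : NoForbidden u
    max≤suffix    : All (maxL τ ≤_) u
    last-or-above : lastL τ ≡ maxL τ ⊎ All (maxL τ <_) u

split-at-first : ∀ {m} σ → All (_≤ m) σ → m ∈ σ → ∃ λ τ → ∃ λ r → σ ≡ τ ++ m ∷ r × All (_< m) τ
split-at-first {m} (x ∷ σ) (x≤m ∷ σ≤m) m∈ with x ≟ m | m∈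
... | yes refl | _          = [] , σ , refl , []
... | no x≢m   | here m≡x  = contradiction (sym m≡x) x≢m
... | no x≢m   | there m∈σ with split-at-first σ σ≤m m∈σ
...   | τ , r , refl , τ<m = x ∷ τ , r , refl , ≤∧≢⇒< x≤m x≢m ∷ τ<m

span-replicate : ∀ m r → ∃ λ k → ∃ λ u → r ≡ replicate k m ++ u × head u ≢ just m
span-replicate m []      = 0 , [] , refl , λ ()
span-replicate m (y ∷ r) with y ≟ m
... | no y≢m = 0 , y ∷ r , refl , y≢m ∘ just-injective
... | yes refl with span-replicate m r
...   | k , u , refl , u≢m = suc k , u , refl , u≢m

suffix-< : ∀ {m} τ k u → NoForbidden (assemble τ m k u) → All (_≤ m) u → head u ≢ just m → All (_< m) u
suffix-<     τ k []      _  _              _   = []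
suffix-< {m} τ k (y ∷ u) nf (y≤m ∷ u≤m) u≢m =
  y<m ∷ All.zipWith (λ (z≤m , z≢m) → ≤∧≢⇒< z≤m z≢m) (u≤m , NoForbidden-101 (m ∷ []) (y ∷ []) nf′ (here refl) (here refl) y<m)
  where
  y<m : y < m
  y<m = ≤∧≢⇒< y≤m (u≢m ∘ cong just)
  nf′ : NoForbidden ((m ∷ []) ++ (y ∷ []) ++ u)
  nf′ = NoForbidden-⊆ (++⁺ˡ τ (refl ∷ ++⁺ˡ (replicate k m) ⊆-refl)) nf

suffix-≢-max : ∀ {m} τ k u → NoForbidden (assemble τ m k u) → lastL τ ≢ maxL τ → All (_≢ maxL τ) u
suffix-≢-max     []      k u nf l≢j = contradiction refl l≢j
suffix-≢-max {m} (x ∷ τ) k u nf l≢j with lastL-split x τ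
... | τ₀ , τ≡ = Allₚ.++⁻ʳ (replicate k m) (All.tail (NoForbidden-101 τ₀ (l ∷ []) nf₀ j∈τ₀ (here refl) l<j))
  where
  j = maxL (x ∷ τ)
  l = lastL (x ∷ τ)
  nf₀ : NoForbidden (τ₀ ++ (l ∷ []) ++ m ∷ (replicate k m ++ u))
  nf₀ = subst NoForbidden (trans (cong (_++ _) τ≡) (++-assoc τ₀ (l ∷ []) _)) nf
  l<j : l < j
  l<j = ≤∧≢⇒< (All.lookup (≤-maxL (x ∷ τ)) (lastL-∈ x τ)) l≢j
  j∈τ₀ : j ∈ τ₀
  j∈τ₀ with ∈-++⁻ τ₀ (subst (j ∈_) τ≡ (maxL-∈ (x ∷ τ) (s≤s z≤n)))
  ... | inj₁ j∈   = j∈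
  ... | inj₂ (here j≡l) = contradiction (sym j≡l) l≢j

decompose : ∀ {m} σ → 0 < m → IsInvList σ → NoForbidden σ → maxL σ ≡ m
  → ∃ λ τ → ∃ λ k → ∃ λ u → σ ≡ assemble τ m k u × Decomposition m τ u
decompose {m} σ 0<m inv nf max≡m with maxL≡⁻ σ 0<m max≡m
... | σ≤m , m∈σ with split-at-first σ σ≤m m∈σ
... | τ , r , refl , τ<m with span-replicate m r
... | k , u , refl , u≢m = τ , k , u , refl , record
  { prefix<m      = τ<m
  ; m≤length      = m≤length
  ; prefix-inv    = proj₁ inv-split
  ; prefix-nf     = NoForbidden-⊆ (++⁺ʳ _ ⊆-refl) nf
  ; suffix<m      = suffix-< τ k u nf (Allₚ.++⁻ʳ (replicate k m) (All.tail (Allₚ.++⁻ʳ τ σ≤m))) u≢m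
  ; suffix-nf     = NoForbidden-⊆ (++⁺ˡ τ (m ∷ʳ ++⁺ˡ (replicate k m) ⊆-refl)) nf
  ; max≤suffix    = max≤suffix
  ; last-or-above = last-or-above
  }
  where
  inv-split = InvFrom-++⁻ 0 τ _ inv
  m≤length : m ≤ length τ
  m≤length = subst (m ≤_) (+-identityʳ (length τ)) (s≤s⁻¹ (proj₁ (proj₂ inv-split)))
  max<m : maxL τ < m
  max<m = maxL-< τ 0<m τ<m
  max∈τ : maxL τ ∈ τ
  max∈τ = maxL-∈ τ (≤-trans 0<m m≤length)
  max≤suffix : All (maxL τ ≤_) u
  max≤suffix = Allₚ.++⁻ʳ (replicate k m) (NoForbidden-120 τ (m ∷ []) nf max∈τ (here refl) max<m)
  last-or-above : lastL τ ≡ maxL τ ⊎ All (maxL τ <_) u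
  last-or-above with lastL τ ≟ maxL τ
  ... | yes l≡j = inj₁ l≡j
  ... | no  l≢j = inj₂ (All.zipWith (λ (j≤y , y≢j) → ≤∧≢⇒< j≤y (y≢j ∘ sym)) (max≤suffix , suffix-≢-max τ k u nf l≢j))

⊆-through-last : ∀ {a b : ℕ} τ → (a ∷ b ∷ []) ⊆ τ → b ≢ lastL τ → (a ∷ b ∷ lastL τ ∷ []) ⊆ τ
⊆-through-last {a} {b} (x ∷ τ) ab⊆ b≢l with lastL-split x τ
... | τ₀ , τ≡ = subst ((a ∷ b ∷ l ∷ []) ⊆_) (sym τ≡) (through τ₀ (subst ((a ∷ b ∷ []) ⊆_) τ≡ ab⊆))
  where
  l = lastL (x ∷ τ)
  through : ∀ τ₀ → (a ∷ b ∷ []) ⊆ τ₀ ++ l ∷ [] → (a ∷ b ∷ l ∷ []) ⊆ τ₀ ++ l ∷ []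
  through τ₀ ab⊆′ with ⊆-++⁻ τ₀ ab⊆′
  ... | _ ∷ _ ∷ [] , [] , refl , ab⊆τ₀ , _ = ++⁺ ab⊆τ₀ ⊆-refl
  ... | _ ∷ [] , _ ∷ [] , refl , _ , b⊆l  = contradiction (to∈ b⊆l) λ { (here b≡l) → b≢l b≡l }
  ... | [] , _ , refl , _ , _ ∷ʳ ()
  ... | [] , _ , refl , _ , refl ∷ ()

NoForbidden-block : ∀ {m} k u → All (_< m) u → NoForbidden u → NoForbidden (m ∷ replicate k m ++ u)
NoForbidden-block {m} k u u<m u-nf = NoForbidden-++ block-nf u-nf block-suffix block²-suffix
  where
  block≡m : All (_≡ m) (m ∷ replicate k m)
  block≡m = refl ∷ Allₚ.replicate⁺ k refl
  block-nf : NoForbidden (m ∷ replicate k m)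
  block-nf abc⊆ with All-resp-⊆ abc⊆ block≡m
  ... | refl ∷ refl ∷ _ = ¬Forbidden-≡
  block-suffix : ∀ {a b c} → a ∈ m ∷ replicate k m → (b ∷ c ∷ []) ⊆ u → ¬ Forbidden a b c
  block-suffix a∈ bc⊆ with All.lookup block≡m a∈ | All-resp-⊆ bc⊆ u<m
  ... | refl | b<m ∷ c<m ∷ [] = ¬Forbidden-top (<⇒≤ b<m) c<m
  block²-suffix : ∀ {a b c} → (a ∷ b ∷ []) ⊆ m ∷ replicate k m → c ∈ u → ¬ Forbidden a b c
  block²-suffix ab⊆ _ with All-resp-⊆ ab⊆ block≡m
  ... | refl ∷ refl ∷ [] = ¬Forbidden-≡

-- The only forbidden triple straddling τ and r would be j, b, j with b < j, which τ would already contain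
-- as j, b, lastL τ.
NoForbidden-++-above : ∀ {j} τ r → NoForbidden τ → NoForbidden r → All (_≤ j) τ → All (j ≤_) r
  → (j ∈ r → lastL τ ≡ j) → NoForbidden (τ ++ r)
NoForbidden-++-above {j} τ r τ-nf r-nf τ≤j j≤r j∈r⇒last≡j = NoForbidden-++ τ-nf r-nf τ-r τ²-r
  where
  τ-r : ∀ {a b c} → a ∈ τ → (b ∷ c ∷ []) ⊆ r → ¬ Forbidden a b c
  τ-r a∈ bc⊆ with All-resp-⊆ bc⊆ j≤r
  ... | j≤b ∷ j≤c ∷ [] = let a≤j = All.lookup τ≤j a∈ in ¬Forbidden-bottom (≤-trans a≤j j≤b) (≤-trans a≤j j≤c)
  τ²-r : ∀ {a b c} → (a ∷ b ∷ []) ⊆ τ → c ∈ r → ¬ Forbidden a b c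
  τ²-r ab⊆ c∈ (inj₂ (c<a , _)) with All-resp-⊆ ab⊆ τ≤j
  ... | a≤j ∷ _ = <⇒≱ c<a (≤-trans a≤j (All.lookup j≤r c∈))
  τ²-r ab⊆ c∈ (inj₁ (b<a , refl)) with All-resp-⊆ ab⊆ τ≤j
  ... | a≤j ∷ _ with ≤-antisym (All.lookup j≤r c∈) a≤j
  ...   | refl = τ-nf (⊆-through-last τ ab⊆ (λ b≡l → <⇒≢ b<a (trans b≡l l≡j))) (inj₁ (b<a , l≡j))
    where
    l≡j = j∈r⇒last≡j c∈

assemble-valid : ∀ {m} τ k u → 0 < m → Decomposition m τ u
  → IsInvList (assemble τ m k u) × NoForbidden (assemble τ m k u) × maxL (assemble τ m k u) ≡ m
assemble-valid {m} τ k u 0<m D =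
  InvFrom-++⁺ 0 τ rest prefix-inv (InvFrom-≤ rest (All.map (λ x≤m → ≤-trans x≤m m≤length+0) rest≤m)) ,
  NoForbidden-++-above τ rest prefix-nf (NoForbidden-block k u suffix<m suffix-nf) (≤-maxL τ) j≤rest j∈rest⇒last≡j ,
  maxL≡⁺ _ (Allₚ.++⁺ (All.map <⇒≤ prefix<m) rest≤m) (∈-++⁺ʳ τ (here refl))
  where
  open Decomposition D
  j = maxL τ
  rest = m ∷ replicate k m ++ u
  j<m : j < m
  j<m = maxL-< τ 0<m prefix<m
  m≤length+0 : m ≤ length τ + 0
  m≤length+0 = subst (m ≤_) (sym (+-identityʳ (length τ))) m≤length
  rest-from : ∀ {P : ℕ → Set} → P m → All P u → All P rest
  rest-from Pm Pu = Pm ∷ Allₚ.++⁺ (Allₚ.replicate⁺ k Pm) Pu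
  rest≤m : All (_≤ m) rest
  rest≤m = rest-from ≤-refl (All.map <⇒≤ suffix<m)
  j≤rest : All (j ≤_) rest
  j≤rest = rest-from (<⇒≤ j<m) max≤suffix
  j∈rest⇒last≡j : j ∈ rest → lastL τ ≡ j
  j∈rest⇒last≡j j∈ with last-or-above
  ... | inj₁ l≡j = l≡j
  ... | inj₂ j<u = contradiction (All.lookup (rest-from j<m j<u) j∈) (<-irrefl refl)

lastL-assemble-[] : ∀ τ m k → lastL (assemble τ m k []) ≡ m
lastL-assemble-[] τ m k = trans (lastL-++ τ m (replicate k m ++ [])) (block k)
  where
  block : ∀ k → lastL (m ∷ (replicate k m ++ [])) ≡ m
  block zero    = refl
  block (suc k) = block k

lastL-assemble-∷ : ∀ τ m k y u → lastL (assemble τ m k (y ∷ u)) ≡ lastL (y ∷ u)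
lastL-assemble-∷ τ m k y u = trans (lastL-++ τ m (replicate k m ++ y ∷ u)) (lastL-++ (m ∷ replicate k m) y u)

suffix-empty : ∀ {m} τ k u → All (_< m) u → lastL (assemble τ m k u) ≡ m → u ≡ []
suffix-empty τ k []      _   _      = refl
suffix-empty τ k (y ∷ u) u<m last≡m =
  contradiction (trans (sym (lastL-assemble-∷ τ _ k y u)) last≡m) (<⇒≢ (All.lookup u<m (lastL-∈ y u)))

prefix-unique : ∀ {m : ℕ} τ τ′ {r r′} → All (_< m) τ → All (_< m) τ′ → τ ++ m ∷ r ≡ τ′ ++ m ∷ r′ → τ ≡ τ′ × r ≡ r′
prefix-unique []      []       _           _            eq = refl , ∷-injectiveʳ eq
prefix-unique []      (_ ∷ _)  _           (x<m ∷ _)   eq = contradiction (sym (∷-injectiveˡ eq)) (<⇒≢ x<m)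
prefix-unique (_ ∷ _) []       (x<m ∷ _)   _            eq = contradiction (∷-injectiveˡ eq) (<⇒≢ x<m)
prefix-unique (x ∷ τ) (y ∷ τ′) (_ ∷ τ<m) (_ ∷ τ′<m) eq with prefix-unique τ τ′ τ<m τ′<m (∷-injectiveʳ eq)
... | refl , r≡r′ = cong (_∷ τ) (∷-injectiveˡ eq) , r≡r′

replicate-++-cancel : ∀ {m : ℕ} k k′ {u u′} → All (_< m) u → All (_< m) u′
  → replicate k m ++ u ≡ replicate k′ m ++ u′ → u ≡ u′
replicate-++-cancel zero    zero     _          _           eq = eq
replicate-++-cancel zero    (suc _) (y<m ∷ _) _           eq = contradiction (∷-injectiveˡ eq) (<⇒≢ y<m)
replicate-++-cancel (suc _) zero     _          (y<m ∷ _) eq = contradiction (sym (∷-injectiveˡ eq)) (<⇒≢ y<m)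
replicate-++-cancel (suc k) (suc k′) u<m        u′<m        eq = replicate-++-cancel k k′ u<m u′<m (∷-injectiveʳ eq)

length-assemble : ∀ τ m k u → length (assemble τ m k u) ≡ length τ + suc (k + length u)
length-assemble τ m k u = begin
  length (τ ++ m ∷ (replicate k m ++ u))           ≡⟨ length-++ τ ⟩
  length τ + suc (length (replicate k m ++ u))     ≡⟨ cong (λ l → length τ + suc l) (length-++ (replicate k m)) ⟩
  length τ + suc (length (replicate k m) + length u) ≡⟨ cong (λ l → length τ + suc (l + length u)) (length-replicate k) ⟩
  length τ + suc (k + length u)                     ∎
  where open ≡-Reasoning

-- Gluing

-- Seq, SeqLast and ShortWord are the list forms of the sets counted by a, a′ and b.
Seq : ℕ → ℕ → List ℕ → Set
Seq N j τ = length τ ≡ N × IsInvList τ × Avoids101-120 τ × maxL τ ≡ j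

SeqLast : ℕ → ℕ → List ℕ → Set
SeqLast N j τ = Seq N j τ × lastL τ ≡ j

SeqNotLast : ℕ → ℕ → List ℕ → Set
SeqNotLast N j τ = Seq N j τ × lastL τ ≢ j

Word : ℕ → List ℕ → Set
Word K v = All (_< K) v × Avoids101-120 v

ShortWord : ℕ → ℕ → List ℕ → Set
ShortWord N K v = length v ≤ N × Word K v

Word-shift-< : ∀ {K s m v} → K + s ≤ m → Word K v → All (λ y → y + s < m) v
Word-shift-< {s = s} K+s≤m (v<K , _) = All.map (λ y<K → <-≤-trans (+-monoˡ-< s y<K) K+s≤m) v<K

map-+-∸ : ∀ s u → All (s ≤_) u → map (_+ s) (map (_∸ s) u) ≡ u
map-+-∸ s []      []            = refl
map-+-∸ s (y ∷ u) (s≤y ∷ s≤u) = cong₂ _∷_ (m∸n+n≡m s≤y) (map-+-∸ s u s≤u)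

unshift-Word : ∀ {m} s u → All (s ≤_) u → All (_< m) u → NoForbidden u → Word (m ∸ s) (map (_∸ s) u)
unshift-Word s u s≤u u<m nf =
  Allₚ.map⁺ (All.zipWith (λ (s≤y , y<m) → ∸-monoˡ-< y<m s≤y) (s≤u , u<m)) ,
  NoForbidden⇒Avoids (Equivalence.from (NoForbidden-map-+ s _) (subst NoForbidden (sym (map-+-∸ s u s≤u)) nf))

m∸suc-j≡m∸j∸1 : ∀ m j → m ∸ suc j ≡ m ∸ j ∸ 1
m∸suc-j≡m∸j∸1 m j = trans (cong (m ∸_) (+-comm 1 j)) (sym (∸-+-assoc m j 1))

m∸j∸1+suc-j≡m : ∀ {m j} → j < m → m ∸ j ∸ 1 + suc j ≡ m
m∸j∸1+suc-j≡m {m} {j} j<m = trans (cong (_+ suc j) (sym (m∸suc-j≡m∸j∸1 m j))) (m∸n+n≡m j<m)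

prefix-Seq : ∀ {m τ u} → Decomposition m τ u → Seq (length τ) (maxL τ) τ
prefix-Seq D = refl , prefix-inv , NoForbidden⇒Avoids prefix-nf , refl
  where open Decomposition D

∸-suc-split : ∀ {n} L X → n ≡ L + suc X → n ∸ suc L ≡ X
∸-suc-split L X refl = trans (cong (_∸ suc L) (+-suc L X)) (m+n∸m≡n (suc L) X)

∸1-injective : ∀ {p p′} → 0 < p → 0 < p′ → p ∸ 1 ≡ p′ ∸ 1 → p ≡ p′
∸1-injective (s≤s _) (s≤s _) eq = cong suc eq

module Gluing (n m : ℕ) (0<m : 0 < m) (m<n : m < n) where

  -- the number of repeated maxima is forced by the total length n
  glue : ℕ → List ℕ × List ℕ → List ℕ
  glue s (τ , v) = assemble τ m (n ∸ suc (length τ) ∸ length v) (map (_+ s) v)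

  Glued : ℕ → (List ℕ → Set) → (List ℕ → Set) → List ℕ → Set
  Glued s T V σ = ∃ λ tv → (T (proj₁ tv) × V (proj₂ tv)) × glue s tv ≡ σ

  -- the two summands of the formula for a, for fixed p and j
  Piece : ℕ → ℕ → List ℕ → Set
  Piece p j σ = Glued j (SeqLast (p ∸ 1) j) (ShortWord (n ∸ p) (m ∸ j)) σ
              ⊎ Glued (suc j) (SeqNotLast (p ∸ 1) j) (ShortWord (n ∸ p) (m ∸ j ∸ 1)) σ

  -- the shift suc j is immaterial, the word being empty
  TopPiece : ℕ → ℕ → List ℕ → Set
  TopPiece p j σ = Glued (suc j) (Seq (p ∸ 1) j) (_≡ []) σ

  PieceUnion : (ℕ → ℕ → List ℕ → Set) → List ℕ → Set
  PieceUnion P σ = ∃ λ p → InRange (suc m) (n ∸ m) p × ∃ λ j → InRange 0 m j × P p j σ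

  suc-m+[n∸m]≡suc-n : suc m + (n ∸ m) ≡ suc n
  suc-m+[n∸m]≡suc-n = cong suc (m+[n∸m]≡n (<⇒≤ m<n))

  InRange-p⁻ : ∀ {p} → InRange (suc m) (n ∸ m) p → m < p × p ≤ n
  InRange-p⁻ {p} (m<p , p<) = m<p , s≤s⁻¹ (subst (p <_) suc-m+[n∸m]≡suc-n p<)

  InRange-p⁺ : ∀ {p} → m < p → p ≤ n → InRange (suc m) (n ∸ m) p
  InRange-p⁺ {p} m<p p≤n = m<p , subst (p <_) (sym suc-m+[n∸m]≡suc-n) (s≤s p≤n)

  length-glue : ∀ s τ v → suc (length τ) ≤ n → length v ≤ n ∸ suc (length τ) → length (glue s (τ , v)) ≡ n
  length-glue s τ v τ<n v≤ = begin
    length (glue s (τ , v))                                 ≡⟨ length-assemble τ m k (map (_+ s) v) ⟩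
    length τ + suc (k + length (map (_+ s) v))              ≡⟨ cong (λ l → length τ + suc (k + l)) (length-map (_+ s) v) ⟩
    length τ + suc (k + length v)                           ≡⟨ cong (λ l → length τ + suc l) (m∸n+n≡m v≤) ⟩
    length τ + suc (n ∸ suc (length τ))                     ≡⟨ +-suc (length τ) _ ⟩
    suc (length τ) + (n ∸ suc (length τ))                   ≡⟨ m+[n∸m]≡n τ<n ⟩
    n                                                       ∎
    where
    open ≡-Reasoning
    k = n ∸ suc (length τ) ∸ length v

  glue≡assemble : ∀ s τ k u v → length (assemble τ m k u) ≡ n → map (_+ s) v ≡ u → glue s (τ , v) ≡ assemble τ m k u
  glue≡assemble s τ k u v |σ|≡n refl = cong (λ k′ → assemble τ m k′ (map (_+ s) v)) k′≡k
    where
    k′≡k : n ∸ suc (length τ) ∸ length v ≡ k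
    k′≡k = begin
      n ∸ suc (length τ) ∸ length v                ≡⟨ cong (_∸ length v) (∸-suc-split (length τ) _ (trans (sym |σ|≡n) (length-assemble τ m k _))) ⟩
      k + length (map (_+ s) v) ∸ length v         ≡⟨ cong (λ l → k + l ∸ length v) (length-map (_+ s) v) ⟩
      k + length v ∸ length v                      ≡⟨ m+n∸n≡m k (length v) ⟩
      k                                            ∎
      where open ≡-Reasoning

  glue-Seq : ∀ {p j s K τ v} → InRange (suc m) (n ∸ m) p → j < m → Seq (p ∸ 1) j τ → ShortWord (n ∸ p) K v
    → K + s ≤ m → j ≤ s → lastL τ ≡ j ⊎ j < s → Seq n m (glue s (τ , v))
  glue-Seq {suc _} {s = s} {K} {τ} {v} p∈ j<m (refl , τ-inv , τ-avoids , refl) (v≤ , v-word@(_ , v-avoids)) K+s≤m j≤s last⊎ =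
    length-glue s τ v p≤n v≤ , inv , NoForbidden⇒Avoids nf , max≡m
    where
    p≤n = proj₂ (InRange-p⁻ p∈)
    D : Decomposition m τ (map (_+ s) v)
    D = record
      { prefix<m      = All<-maxL τ refl j<m
      ; m≤length      = s≤s⁻¹ (proj₁ p∈)
      ; prefix-inv    = τ-inv
      ; prefix-nf     = Avoids⇒NoForbidden τ-avoids
      ; suffix<m      = Allₚ.map⁺ (Word-shift-< K+s≤m v-word)
      ; suffix-nf     = Equivalence.to (NoForbidden-map-+ s v) (Avoids⇒NoForbidden v-avoids)
      ; max≤suffix    = Allₚ.map⁺ (All.tabulate λ {y} _ → ≤-trans j≤s (m≤n+m s y))
      ; last-or-above = Sum.map₂ (λ j<s → Allₚ.map⁺ (All.tabulate λ {y} _ → <-≤-trans j<s (m≤n+m s y))) last⊎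
      }
    valid = assemble-valid τ _ (map (_+ s) v) 0<m D
    inv = proj₁ valid
    nf = proj₁ (proj₂ valid)
    max≡m = proj₂ (proj₂ valid)

  Piece⇒Seq : ∀ {p j σ} → InRange (suc m) (n ∸ m) p → j < m → Piece p j σ → Seq n m σ
  Piece⇒Seq p∈ j<m (inj₁ (_ , ((τ-seq , l≡j) , v-word) , refl)) =
    glue-Seq p∈ j<m τ-seq v-word (≤-reflexive (m∸n+n≡m (<⇒≤ j<m))) ≤-refl (inj₁ l≡j)
  Piece⇒Seq {j = j} p∈ j<m (inj₂ (_ , ((τ-seq , _) , v-word) , refl)) =
    glue-Seq p∈ j<m τ-seq v-word (≤-reflexive (m∸j∸1+suc-j≡m j<m)) (n≤1+n j) (inj₂ ≤-refl)

  TopPiece⇒SeqLast : ∀ {p j σ} → InRange (suc m) (n ∸ m) p → j < m → TopPiece p j σ → SeqLast n m σ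
  TopPiece⇒SeqLast {j = j} p∈ j<m ((τ , _) , (τ-seq , refl) , refl) =
    glue-Seq {K = 0} p∈ j<m τ-seq (z≤n , [] , NoForbidden⇒Avoids λ ()) j<m (n≤1+n j) (inj₂ ≤-refl) ,
    lastL-assemble-[] τ m _

  decompose-Seq : ∀ {σ} → Seq n m σ → ∃ λ τ → ∃ λ k → ∃ λ u → σ ≡ assemble τ m k u × Decomposition m τ u
    × InRange (suc m) (n ∸ m) (suc (length τ)) × n ∸ suc (length τ) ≡ k + length u
  decompose-Seq {σ} (|σ|≡n , inv , avoids , max≡m) with decompose σ 0<m inv (Avoids⇒NoForbidden avoids) max≡m
  ... | τ , k , u , refl , D = τ , k , u , refl , D , InRange-p⁺ (s≤s (Decomposition.m≤length D)) τ<n , n∸p≡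
    where
    n≡ : n ≡ length τ + suc (k + length u)
    n≡ = trans (sym |σ|≡n) (length-assemble τ m k u)
    n∸p≡ : n ∸ suc (length τ) ≡ k + length u
    n∸p≡ = ∸-suc-split (length τ) _ n≡
    τ<n : suc (length τ) ≤ n
    τ<n = subst (suc (length τ) ≤_) (trans (sym (+-suc (length τ) _)) (sym n≡)) (m≤m+n (suc (length τ)) _)

  Seq⇒Piece : ∀ {σ} → Seq n m σ → PieceUnion Piece σ
  Seq⇒Piece σ-seq@(|σ|≡n , _) with decompose-Seq σ-seq
  ... | τ , k , u , refl , D , p∈ , n∸p≡ =
    suc (length τ) , p∈ , j , (z≤n , maxL-< τ 0<m prefix<m) , piece (lastL τ ≟ j)
    where
    open Decomposition D
    j = maxL τ
    τ-seq = prefix-Seq D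
    short : ∀ s → length (map (_∸ s) u) ≤ n ∸ suc (length τ)
    short s = subst₂ _≤_ (sym (length-map (_∸ s) u)) (sym n∸p≡) (m≤n+m (length u) k)
    piece : Dec (lastL τ ≡ j) → Piece (suc (length τ)) j (assemble τ m k u)
    piece (yes l≡j) =
      inj₁ (_ , ((τ-seq , l≡j) , short j , unshift-Word j u max≤suffix suffix<m suffix-nf)
              , glue≡assemble j τ k u _ |σ|≡n (map-+-∸ j u max≤suffix))
    piece (no l≢j) with last-or-above
    ... | inj₁ l≡j = contradiction l≡j l≢j
    ... | inj₂ j<u =
      inj₂ (_ , ((τ-seq , l≢j) , short (suc j) , subst (λ K → Word K (map (_∸ suc j) u)) (m∸suc-j≡m∸j∸1 m j)
                                                       (unshift-Word (suc j) u j<u suffix<m suffix-nf))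
              , glue≡assemble (suc j) τ k u _ |σ|≡n (map-+-∸ (suc j) u j<u))

  SeqLast⇒TopPiece : ∀ {σ} → SeqLast n m σ → PieceUnion TopPiece σ
  SeqLast⇒TopPiece (σ-seq@(|σ|≡n , _) , last≡m) with decompose-Seq σ-seq
  ... | τ , k , u , refl , D , p∈ , _ with suffix-empty τ k u (Decomposition.suffix<m D) last≡m
  ... | refl = suc (length τ) , p∈ , maxL τ , (z≤n , maxL-< τ 0<m (Decomposition.prefix<m D)) ,
               ((τ , []) , (prefix-Seq D , refl) , glue≡assemble (suc (maxL τ)) τ k [] [] |σ|≡n refl)

  glue-injective : ∀ s {τ τ′ v v′} → All (_< m) τ → All (_< m) τ′ → All (λ y → y + s < m) v → All (λ y → y + s < m) v′
    → glue s (τ , v) ≡ glue s (τ′ , v′) → (τ , v) ≡ (τ′ , v′)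
  glue-injective s τ<m τ′<m v<m v′<m eq with prefix-unique _ _ τ<m τ′<m eq
  ... | refl , rest≡ =
    cong (_ ,_) (map-injective (λ {x} {y} → +-cancelʳ-≡ s x y)
                  (replicate-++-cancel _ _ (Allₚ.map⁺ v<m) (Allₚ.map⁺ v′<m) rest≡))

  IsCount-Glued : ∀ s {T V : List ℕ → Set} {x y} → (∀ {τ} → T τ → All (_< m) τ) → (∀ {v} → V v → All (λ z → z + s < m) v)
    → IsCount T x → IsCount V y → IsCount (Glued s T V) (x * y)
  IsCount-Glued s T<m V<m T# V# =
    IsCount-image (glue s) (λ (t , v) (t′ , v′) → glue-injective s (T<m t) (T<m t′) (V<m v) (V<m v′)) (IsCount-× T# V#)

  Piece-disjoint : ∀ {p j σ} → j < m
    → Glued j (SeqLast (p ∸ 1) j) (ShortWord (n ∸ p) (m ∸ j)) σ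
    → ¬ Glued (suc j) (SeqNotLast (p ∸ 1) j) (ShortWord (n ∸ p) (m ∸ j ∸ 1)) σ
  Piece-disjoint j<m ((τ , _) , (((_ , _ , _ , max≡j) , l≡j) , _) , refl) ((τ′ , _) , (((_ , _ , _ , max′≡j) , l≢j) , _) , eq)
    with prefix-unique τ′ τ (All<-maxL τ′ max′≡j j<m) (All<-maxL τ max≡j j<m) eq
  ... | refl , _ = l≢j l≡j

  record SplitsAt (p j : ℕ) (σ : List ℕ) : Set where
    constructor splitsAt
    field
      prefix        : List ℕ
      rest          : List ℕ
      σ≡            : σ ≡ prefix ++ m ∷ rest
      prefix<m      : All (_< m) prefix
      length-prefix : length prefix ≡ p ∸ 1
      max-prefix    : maxL prefix ≡ j

  SplitsAt-unique : ∀ {p p′ j j′ σ} → SplitsAt p j σ → SplitsAt p′ j′ σ → p ∸ 1 ≡ p′ ∸ 1 × j ≡ j′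
  SplitsAt-unique (splitsAt τ _ refl τ<m |τ| max≡j) (splitsAt τ′ _ eq τ′<m |τ′| max′≡j′)
    with prefix-unique τ τ′ τ<m τ′<m eq
  ... | refl , _ = trans (sym |τ|) |τ′| , trans (sym max≡j) max′≡j′

  Glued⇒SplitsAt : ∀ {p j s T V σ} → j < m → (∀ {τ} → T τ → Seq (p ∸ 1) j τ) → Glued s T V σ → SplitsAt p j σ
  Glued⇒SplitsAt j<m T⇒Seq ((τ , _) , (t , _) , refl) with T⇒Seq t
  ... | |τ| , _ , _ , max≡j = splitsAt τ _ refl (All<-maxL τ max≡j j<m) |τ| max≡j

  Piece⇒SplitsAt : ∀ {p j σ} → j < m → Piece p j σ → SplitsAt p j σ
  Piece⇒SplitsAt j<m (inj₁ g) = Glued⇒SplitsAt j<m proj₁ g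
  Piece⇒SplitsAt j<m (inj₂ g) = Glued⇒SplitsAt j<m proj₁ g

  TopPiece⇒SplitsAt : ∀ {p j σ} → j < m → TopPiece p j σ → SplitsAt p j σ
  TopPiece⇒SplitsAt j<m = Glued⇒SplitsAt j<m (λ τ-seq → τ-seq)

  IsCount-PieceUnion : ∀ {P : ℕ → ℕ → List ℕ → Set} (f : ℕ → ℕ → ℕ)
    → (∀ p j → InRange (suc m) (n ∸ m) p → j < m → IsCount (P p j) (f p j))
    → (∀ {p j σ} → j < m → P p j σ → SplitsAt p j σ)
    → IsCount (PieceUnion P) (sumFrom (suc m) (n ∸ m) (λ p → sumFrom 0 m (f p)))
  IsCount-PieceUnion f count splits =
    IsCount-Σ-range _ _ (suc m) (n ∸ m)
      (λ p p∈ → IsCount-Σ-range _ _ 0 m (λ j (_ , j<m) → count p j p∈ j<m)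
                  (λ (_ , j<m) (_ , j′<m) x y → proj₂ (SplitsAt-unique (splits j<m x) (splits j′<m y))))
      λ (1+m≤p , _) (1+m≤p′ , _) (_ , (_ , j<m) , x) (_ , (_ , j′<m) , y) →
        ∸1-injective (≤-trans (s≤s z≤n) 1+m≤p) (≤-trans (s≤s z≤n) 1+m≤p′)
                     (proj₁ (SplitsAt-unique (splits j<m x) (splits j′<m y)))

-- The recurrences

IsCount-[] : IsCount (λ (v : List ℕ) → v ≡ []) 1
IsCount-[] = List.[ [] ] , [] ∷ [] , (λ _ → mk⇔ (λ { (here refl) → refl }) (λ { refl → here refl })) , refl

module Recurrence
  (a a′ w : ℕ → ℕ → ℕ)
  (count-a : (n m : ℕ) → IsCount (λ (σ : Vec ℕ n) → IsInvSeq σ × Avoids101-120 (toList σ) × maxSeq σ ≡ m) (a n m))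
  (count-a′ : (n m : ℕ) → IsCount (λ (σ : Vec ℕ (suc n)) → IsInvSeq σ × Avoids101-120 (toList σ) × maxSeq σ ≡ m × last σ ≡ m) (a′ (suc n) m))
  (count-w : (l k : ℕ) → IsCount (λ (v : Vec ℕ l) → IsWord k v × Avoids101-120 (toList v)) (w l k))
  where

  b : ℕ → ℕ → ℕ
  b N K = sumFrom 0 (suc N) (λ l → w l K)

  IsCount-Seq : ∀ N j → IsCount (Seq N j) (a N j)
  IsCount-Seq N j = IsCount-toList N _ (IsCount-resp inv⇔ (count-a N j))
    where
    inv⇔ : ∀ (σ : Vec ℕ N) → (IsInvSeq σ × Avoids101-120 (toList σ) × maxSeq σ ≡ j)
                           ⇔ (IsInvList (toList σ) × Avoids101-120 (toList σ) × maxL (toList σ) ≡ j)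
    inv⇔ σ = mk⇔ (Product.map₁ (Equivalence.to (IsInvSeq⇔InvFrom σ 0))) (Product.map₁ (Equivalence.from (IsInvSeq⇔InvFrom σ 0)))

  IsCount-SeqLast : ∀ N j → IsCount (SeqLast (suc N) j) (a′ (suc N) j)
  IsCount-SeqLast N j =
    IsCount-resp reassociate (IsCount-toList (suc N) _ (IsCount-resp inv-last⇔ (count-a′ N j)))
    where
    reassociate : ∀ s → (length s ≡ suc N × IsInvList s × Avoids101-120 s × maxL s ≡ j × lastL s ≡ j) ⇔ SeqLast (suc N) j s
    reassociate _ = mk⇔ (λ (|σ| , inv , av , max , last) → (|σ| , inv , av , max) , last)
                        (λ ((|σ| , inv , av , max) , last) → |σ| , inv , av , max , last)
    inv-last⇔ : ∀ (σ : Vec ℕ (suc N)) → (IsInvSeq σ × Avoids101-120 (toList σ) × maxSeq σ ≡ j × last σ ≡ j)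
                                      ⇔ (IsInvList (toList σ) × Avoids101-120 (toList σ) × maxL (toList σ) ≡ j × lastL (toList σ) ≡ j)
    inv-last⇔ σ = mk⇔ (λ (inv , av , max , last) → Equivalence.to (IsInvSeq⇔InvFrom σ 0) inv , av , max , trans (sym (last≡lastL σ)) last)
                      (λ (inv , av , max , last) → Equivalence.from (IsInvSeq⇔InvFrom σ 0) inv , av , max , trans (last≡lastL σ) last)

  IsCount-SeqNotLast : ∀ N j → IsCount (SeqNotLast (suc N) j) (a (suc N) j ∸ a′ (suc N) j)
  IsCount-SeqNotLast N j = IsCount-∖ (λ τ → lastL τ ≟ j) (IsCount-Seq (suc N) j) (IsCount-SeqLast N j)

  IsCount-ShortWord : ∀ N K → IsCount (ShortWord N K) (b N K)
  IsCount-ShortWord N K =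
    IsCount-resp (λ v → mk⇔ (λ { (_ , (_ , l<) , refl , word) → s≤s⁻¹ l< , word })
                            (λ (|v|≤ , word) → length v , (z≤n , s≤s |v|≤) , refl , word))
      (IsCount-Σ-range _ _ 0 (suc N) (λ l _ → IsCount-Word l) (λ _ _ (|v| , _) (|v|′ , _) → trans (sym |v|) |v|′))
    where
    IsCount-Word : ∀ l → IsCount (λ v → length v ≡ l × Word K v) (w l K)
    IsCount-Word l = IsCount-toList l _ (IsCount-resp (λ v → mk⇔ (Product.map₁ (Equivalence.to (IsWord⇔All K v)))
                                                                  (Product.map₁ (Equivalence.from (IsWord⇔All K v))))
                                                       (count-w l K))

  -- a′ is only specified at positive lengths
  module _ (n′ m : ℕ) (0<m : 0 < m) (m<n : m < suc n′) where

    n = suc n′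
    open Gluing n m 0<m m<n

    IsCount-Piece : ∀ p j → InRange (suc m) (n ∸ m) p → j < m → IsCount (Piece p j)
      (a′ (p ∸ 1) j * b (n ∸ p) (m ∸ j) + (a (p ∸ 1) j ∸ a′ (p ∸ 1) j) * b (n ∸ p) (m ∸ j ∸ 1))
    IsCount-Piece (suc (suc q)) j _ j<m =
      IsCount-⊎ (IsCount-Glued j (λ ((_ , _ , _ , max≡j) , _) → All<-maxL _ max≡j j<m)
                                 (Word-shift-< (≤-reflexive (m∸n+n≡m (<⇒≤ j<m))) ∘ proj₂)
                                 (IsCount-SeqLast q j) (IsCount-ShortWord _ _))
                (IsCount-Glued (suc j) (λ ((_ , _ , _ , max≡j) , _) → All<-maxL _ max≡j j<m)
                                       (Word-shift-< (≤-reflexive (m∸j∸1+suc-j≡m j<m)) ∘ proj₂)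
                                       (IsCount-SeqNotLast q j) (IsCount-ShortWord _ _))
                (λ _ → Piece-disjoint {suc (suc q)} j<m)
    IsCount-Piece (suc zero) j (s≤s m≤0 , _) _ = contradiction m≤0 (<⇒≱ 0<m)

    IsCount-TopPiece : ∀ p j → InRange (suc m) (n ∸ m) p → j < m → IsCount (TopPiece p j) (a (p ∸ 1) j)
    IsCount-TopPiece p j _ j<m =
      subst (IsCount (TopPiece p j)) (*-identityʳ (a (p ∸ 1) j))
        (IsCount-Glued (suc j) (λ (_ , _ , _ , max≡j) → All<-maxL _ max≡j j<m) (λ { refl → [] })
                       (IsCount-Seq (p ∸ 1) j) IsCount-[])

    a-recurrence : a n m ≡ sumFrom (suc m) (n ∸ m) (λ p → sumFrom 0 m (λ j →
      a′ (p ∸ 1) j * b (n ∸ p) (m ∸ j) + (a (p ∸ 1) j ∸ a′ (p ∸ 1) j) * b (n ∸ p) (m ∸ j ∸ 1)))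
    a-recurrence = IsCount-unique (IsCount-Seq n m)
      (IsCount-resp (λ _ → mk⇔ (λ (_ , p∈ , _ , (_ , j<m) , piece) → Piece⇒Seq p∈ j<m piece) Seq⇒Piece)
        (IsCount-PieceUnion _ IsCount-Piece Piece⇒SplitsAt))

    a′-recurrence : a′ n m ≡ sumFrom (suc m) (n ∸ m) (λ p → sumFrom 0 m (λ j → a (p ∸ 1) j))
    a′-recurrence = IsCount-unique (IsCount-SeqLast n′ m)
      (IsCount-resp (λ _ → mk⇔ (λ (_ , p∈ , _ , (_ , j<m) , piece) → TopPiece⇒SeqLast p∈ j<m piece) SeqLast⇒TopPiece)
        (IsCount-PieceUnion _ IsCount-TopPiece TopPiece⇒SplitsAt))

theorem16 : (a a' w : ℕ → ℕ → ℕ)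
  → ((n m : ℕ) → IsCount (λ (σ : Vec ℕ n) → IsInvSeq σ × Avoids101-120 (toList σ) × maxSeq σ ≡ m) (a n m))
  → ((n m : ℕ) → IsCount (λ (σ : Vec ℕ (suc n)) → IsInvSeq σ × Avoids101-120 (toList σ) × maxSeq σ ≡ m × last σ ≡ m) (a' (suc n) m))
  → ((l k : ℕ) → IsCount (λ (v : Vec ℕ l) → IsWord k v × Avoids101-120 (toList v)) (w l k))
  → let b : ℕ → ℕ → ℕ
        b n k = sumFrom 0 (suc n) (λ l → w l k)
    in (n m : ℕ) → 0 < m → m < n
    → (a n m ≡ sumFrom (suc m) (n ∸ m) (λ p → sumFrom 0 m (λ j →
            a' (p ∸ 1) j * b (n ∸ p) (m ∸ j) + (a (p ∸ 1) j ∸ a' (p ∸ 1) j) * b (n ∸ p) (m ∸ j ∸ 1))))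
    × (a' n m ≡ sumFrom (suc m) (n ∸ m) (λ p → sumFrom 0 m (λ j → a (p ∸ 1) j)))
theorem16 a a′ w count-a count-a′ count-w zero    m 0<m ()
theorem16 a a′ w count-a count-a′ count-w (suc n) m 0<m m<n =
  a-recurrence n m 0<m m<n , a′-recurrence n m 0<m m<n
  where open Recurrence a a′ w count-a count-a′ count-w using (a-recurrence; a′-recurrence)
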